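{- Consider the following incremental coloring procedure on a graph with $n$ vertices, starting from the empty graph with every vertex colored $1$, and processing a sequence of edge insertions such that the graph remains bipartite. When an edge $\{x,y\}$ is inserted: if $x$ and $y$ have different colors, nothing is recolored; if they have the same color, one of the endpoints, say $v$, is chosen, and, considering the bipartition into two independent sets $P_1 \ni v$ and $P_2$ of the connected component containing $v$ (after inserting the edge), $v$ is recolored with the smallest positive integer color not used by any vertex of $P_2$. Then at every time, if a connected component of the graph contains a vertex with color $t$, that component has at least $2^{\lfloor t/2 \rfloor}$ vertices. Consequently the total number of colors used by the procedure is at most $1 + 2\log n$.
   Context: Colors are positive integers. Logarithms are base 2. -}

module Defs where

open import Data.Nat using (ℕ; zero; suc; _≤_; _<_; _%_)
open import Data.Fin using (Fin; _≟_)
open import Data.Bool using (Bool)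
open import Data.List using (List; []; _∷_)
open import Data.List.Membership.Propositional using (_∈_)
open import Data.Product using (_×_; _,_; ∃; ∃-syntax; Σ-syntax)
open import Data.Sum using (_⊎_)
open import Relation.Binary.PropositionalEquality using (_≡_; _≢_)
open import Relation.Nullary using (yes; no)

Edge : ℕ → Set
Edge n = Fin n × Fin n

Graph : ℕ → Set
Graph n = List (Edge n)

Coloring : ℕ → Set
Coloring n = Fin n → ℕ

Adj : ∀ {n} → Graph n → Fin n → Fin n → Set
Adj E u w = ((u , w) ∈ E) ⊎ ((w , u) ∈ E)

data Walk {n : ℕ} (E : Graph n) : Fin n → Fin n → ℕ → Set where
  here : ∀ {u} → Walk E u u 0
  step : ∀ {u w z k} → Adj E u w → Walk E w z k → Walk E u z (suc k)

Connected : ∀ {n} → Graph n → Fin n → Fin n → Set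
Connected E u w = ∃[ k ] Walk E u w k

Bipartite : ∀ {n} → Graph n → Set
Bipartite {n} E = Σ[ side ∈ (Fin n → Bool) ] (∀ {u w} → (u , w) ∈ E → side u ≢ side w)

-- In a bipartite graph, the side P₂ of the component of v not containing v
-- consists exactly of the vertices reachable from v by a walk of odd length.
OtherSide : ∀ {n} → Graph n → Fin n → Fin n → Set
OtherSide E v w = ∃[ k ] (Walk E v w k × k % 2 ≡ 1)

IsSmallestFree : ∀ {n} → (Fin n → Set) → Coloring n → ℕ → Set
IsSmallestFree P c m =
  (1 ≤ m)
  × (∀ w → P w → c w ≢ m)
  × (∀ k → 1 ≤ k → k < m → ∃[ w ] (P w × c w ≡ k))

recolor : ∀ {n} → Coloring n → Fin n → ℕ → Coloring n
recolor c v m w with w ≟ v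
... | yes _ = m
... | no _ = c w

data Reachable {n : ℕ} : Graph n → Coloring n → Set where
  start : Reachable [] (λ _ → 1)
  insert-diff : ∀ {E c x y} → Reachable E c → Bipartite ((x , y) ∷ E)
    → c x ≢ c y → Reachable ((x , y) ∷ E) c
  insert-same : ∀ {E c x y v m} → Reachable E c → Bipartite ((x , y) ∷ E)
    → c x ≡ c y → (v ≡ x ⊎ v ≡ y)
    → IsSmallestFree (OtherSide ((x , y) ∷ E) v) c m
    → Reachable ((x , y) ∷ E) (recolor c v m)

-- Write g t = 2 ^ ⌊t/2⌋.  Together with the bound g (c u) on the size of the
-- component of every vertex u, the procedure maintains two auxiliary facts:
-- two vertices on opposite sides with the same color t lie in a component of
-- size at least g (t + 2) = 2 g t, and a vertex of color t ≥ 2 either sees the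
-- color t − 1 on its other side or lies in a component of size at least
-- g (t + 1).  An inserted edge can only create a new equal-color pair across
-- sides by joining two components, each of size at least g t, which doubles the
-- bound.  A recolored vertex v gets the smallest color m missing on its other
-- side, so m − 1 and m − 2 occur there on a common side; the vertex colored
-- m − 1 either sees m − 2 on its other side, giving a same-color pair of color
-- m − 2 across sides, or certifies the size g m directly.
module Submission where

open import Defs
open import Data.Nat using (ℕ; zero; suc; _+_; _*_; _^_; _/_; _%_; _∸_; _≤_; z≤n; s≤s; s≤s⁻¹)
open import Data.Nat.Properties
  using (+-suc; +-identityʳ; suc-injective; ≤-refl; ≤-trans; ≤-reflexive; n≤1+n; +-mono-≤;
         +-monoˡ-≤; m≤n+o⇒m∸n≤o; ^-monoˡ-≤; ^-monoʳ-≤; ^-*-assoc; module ≤-Reasoning)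
open import Data.Nat.DivMod using (m/n≡1+[m∸n]/n; m≡m%n+[m/n]*n; m%n<n; %-distribˡ-+; /-monoˡ-≤)
open import Data.Fin using (Fin; zero; suc; _≟_)
open import Data.Fin.Subset using (Subset; inside; outside; Nonempty; ∣_∣; _∈_; ⁅_⁆; _∪_; _∩_)
open import Data.Fin.Subset.Properties using (∣⁅x⁆∣≡1; x∈⁅y⁆⇒x≡y; x∈p∪q⁻; x∈p∩q⁻; ∣p∣≤n)
open import Data.Bool using (Bool; not)
open import Data.Bool.Properties using (not-involutive; not-¬; ¬-not)
open import Data.List using (_∷_; [])
open import Data.List.Relation.Unary.Any using (here; there)
open import Data.Vec using (_∷_; [])
open import Data.Vec.Base using (here; there)
open import Data.Product using (_×_; _,_; proj₁; proj₂; ∃-syntax)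
open import Data.Sum using (_⊎_; inj₁; inj₂; [_,_]; map; map₁)
open import Data.Empty using (⊥-elim)
open import Function using (_∘_)
open import Relation.Binary.PropositionalEquality
  using (_≡_; _≢_; refl; sym; trans; cong; subst; ≢-sym; module ≡-Reasoning)
open import Relation.Nullary using (yes; no)

module _ {n : ℕ} {E : Graph n} where

  Adj-sym : ∀ {u w} → Adj E u w → Adj E w u
  Adj-sym (inj₁ uw) = inj₂ uw
  Adj-sym (inj₂ wu) = inj₁ wu

  _++ʷ_ : ∀ {a b d k l} → Walk E a b k → Walk E b d l → Walk E a d (k + l)
  here     ++ʷ q = q
  step e p ++ʷ q = step e (p ++ʷ q)

  reverse-onto : ∀ {a b d k l} → Walk E a b k → Walk E a d l → Walk E b d (k + l)
  reverse-onto here acc = acc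
  reverse-onto {k = suc k} {l} (step e p) acc =
    subst (Walk E _ _) (+-suc k l) (reverse-onto p (step (Adj-sym e) acc))

  reverseʷ : ∀ {a b k} → Walk E a b k → Walk E b a k
  reverseʷ {k = k} p = subst (Walk E _ _) (+-identityʳ k) (reverse-onto p here)

  Connected-sym : ∀ {a b} → Connected E a b → Connected E b a
  Connected-sym (k , p) = k , reverseʷ p

  Connected-trans : ∀ {a b d} → Connected E a b → Connected E b d → Connected E a d
  Connected-trans (k , p) (l , q) = k + l , p ++ʷ q

module _ {n : ℕ} {E : Graph n} {e : Edge n} where

  Adj-weaken : ∀ {u w} → Adj E u w → Adj (e ∷ E) u w
  Adj-weaken = map there there

  Walk-weaken : ∀ {a b k} → Walk E a b k → Walk (e ∷ E) a b k
  Walk-weaken here       = here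
  Walk-weaken (step a p) = step (Adj-weaken a) (Walk-weaken p)

  Connected-weaken : ∀ {a b} → Connected E a b → Connected (e ∷ E) a b
  Connected-weaken (k , p) = k , Walk-weaken p

notⁿ : ℕ → Bool → Bool
notⁿ zero    b = b
notⁿ (suc k) b = notⁿ k (not b)

%2-cases : ∀ k → k % 2 ≡ 0 ⊎ k % 2 ≡ 1
%2-cases 0             = inj₁ refl
%2-cases 1             = inj₂ refl
%2-cases (suc (suc k)) = %2-cases k

%2-+ : ∀ k l {i j} → k % 2 ≡ i → l % 2 ≡ j → (k + l) % 2 ≡ (i + j) % 2
%2-+ k l refl refl = %-distribˡ-+ k l 2

notⁿ-even : ∀ k b → k % 2 ≡ 0 → notⁿ k b ≡ b
notⁿ-even 0             b _    = refl
notⁿ-even (suc (suc k)) b even = trans (cong (notⁿ k) (not-involutive b)) (notⁿ-even k b even)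

notⁿ-odd : ∀ k b → k % 2 ≡ 1 → notⁿ k b ≡ not b
notⁿ-odd 1             b _   = refl
notⁿ-odd (suc (suc k)) b odd = trans (cong (notⁿ k) (not-involutive b)) (notⁿ-odd k b odd)

module _ {n : ℕ} {E : Graph n} (B : Bipartite E) where

  private
    side : Fin n → Bool
    side = proj₁ B

  Adj⇒side-flips : ∀ {u w} → Adj E u w → side w ≡ not (side u)
  Adj⇒side-flips (inj₁ uw) = ¬-not (≢-sym (proj₂ B uw))
  Adj⇒side-flips (inj₂ wu) = ¬-not (proj₂ B wu)

  Walk⇒side : ∀ {a b k} → Walk E a b k → side b ≡ notⁿ k (side a)
  Walk⇒side here = refl
  Walk⇒side {k = suc k} (step e p) = trans (Walk⇒side p) (cong (notⁿ k) (Adj⇒side-flips e))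

  odd-Walk⇒sides-differ : ∀ {a b k} → Walk E a b k → k % 2 ≡ 1 → side a ≢ side b
  odd-Walk⇒sides-differ {a} {k = k} p odd same =
    not-¬ refl (trans same (trans (Walk⇒side p) (notⁿ-odd k (side a) odd)))

  sides-differ⇒odd-Walk : ∀ {a b k} → Walk E a b k → side a ≢ side b → k % 2 ≡ 1
  sides-differ⇒odd-Walk {a} {k = k} p differ with %2-cases k
  ... | inj₂ odd  = odd
  ... | inj₁ even = ⊥-elim (differ (sym (trans (Walk⇒side p) (notⁿ-even k (side a) even))))

  OtherSide-irrefl : ∀ {a b} → OtherSide E a b → a ≢ b
  OtherSide-irrefl (k , p , odd) refl = odd-Walk⇒sides-differ p odd refl

Connected⇒OtherSide : ∀ {n} {E : Graph n} {e a b} → Bipartite (e ∷ E)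
  → Connected E a b → OtherSide (e ∷ E) a b → OtherSide E a b
Connected⇒OtherSide B (k , p) (l , q , odd) =
  k , p , sides-differ⇒odd-Walk B (Walk-weaken p) (odd-Walk⇒sides-differ B q odd)

SameSide : ∀ {n} → Graph n → Fin n → Fin n → Set
SameSide E a b = ∃[ k ] (Walk E a b k × k % 2 ≡ 0)

module _ {n : ℕ} {E : Graph n} where

  Adj⇒OtherSide : ∀ {a b} → Adj E a b → OtherSide E a b
  Adj⇒OtherSide a~b = 1 , step a~b here , refl

  OtherSide-sym : ∀ {a b} → OtherSide E a b → OtherSide E b a
  OtherSide-sym (k , p , odd) = k , reverseʷ p , odd

  SameSide-sym : ∀ {a b} → SameSide E a b → SameSide E b a
  SameSide-sym (k , p , even) = k , reverseʷ p , even

  OtherSide-trans : ∀ {a b d} → OtherSide E a b → OtherSide E b d → SameSide E a d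
  OtherSide-trans (k , p , odd) (l , q , odd′) = k + l , p ++ʷ q , %2-+ k l odd odd′

  SameSide-OtherSide-trans : ∀ {a b d} → SameSide E a b → OtherSide E b d → OtherSide E a d
  SameSide-OtherSide-trans (k , p , even) (l , q , odd) = k + l , p ++ʷ q , %2-+ k l even odd

  OtherSide⇒Connected : ∀ {a b} → OtherSide E a b → Connected E a b
  OtherSide⇒Connected (k , p , _) = k , p

  SameSide⇒Connected : ∀ {a b} → SameSide E a b → Connected E a b
  SameSide⇒Connected (k , p , _) = k , p

ComponentSize≥ : ∀ {n} → Graph n → Fin n → ℕ → Set
ComponentSize≥ {n} E u K = ∃[ S ] ((K ≤ ∣ S ∣) × (∀ w → w ∈ S → Connected E u w))

module _ {n : ℕ} {E : Graph n} where

  ComponentSize≥-mono : ∀ {u K K′} → K ≤ K′ → ComponentSize≥ E u K′ → ComponentSize≥ E u K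
  ComponentSize≥-mono K≤K′ (S , K′≤ , S⊆) = S , ≤-trans K≤K′ K′≤ , S⊆

  ComponentSize≥-transport : ∀ {u u′ K} → Connected E u u′
    → ComponentSize≥ E u′ K → ComponentSize≥ E u K
  ComponentSize≥-transport u~u′ (S , K≤ , S⊆) = S , K≤ , λ w w∈S → Connected-trans u~u′ (S⊆ w w∈S)

  ComponentSize≥-weaken : ∀ {e u K} → ComponentSize≥ E u K → ComponentSize≥ (e ∷ E) u K
  ComponentSize≥-weaken (S , K≤ , S⊆) = S , K≤ , λ w w∈S → Connected-weaken (S⊆ w w∈S)

  ComponentSize≥⇒≤n : ∀ {u K} → ComponentSize≥ E u K → K ≤ n
  ComponentSize≥⇒≤n (S , K≤ , _) = ≤-trans K≤ (∣p∣≤n S)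

Nonempty-∷ : ∀ {n} {p : Subset n} s → Nonempty p → Nonempty (s ∷ p)
Nonempty-∷ _ (x , x∈p) = suc x , there x∈p

overlap-or-∣p∣+∣q∣≤∣p∪q∣ : ∀ {n} (p q : Subset n) → Nonempty (p ∩ q) ⊎ ∣ p ∣ + ∣ q ∣ ≤ ∣ p ∪ q ∣
overlap-or-∣p∣+∣q∣≤∣p∪q∣ []            []            = inj₂ z≤n
overlap-or-∣p∣+∣q∣≤∣p∪q∣ (inside  ∷ p) (inside  ∷ q) = inj₁ (zero , here)
overlap-or-∣p∣+∣q∣≤∣p∪q∣ (inside  ∷ p) (outside ∷ q) =
  map (Nonempty-∷ _) s≤s (overlap-or-∣p∣+∣q∣≤∣p∪q∣ p q)
overlap-or-∣p∣+∣q∣≤∣p∪q∣ (outside ∷ p) (inside  ∷ q) =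
  map (Nonempty-∷ _) (λ le → ≤-trans (≤-reflexive (+-suc ∣ p ∣ ∣ q ∣)) (s≤s le))
    (overlap-or-∣p∣+∣q∣≤∣p∪q∣ p q)
overlap-or-∣p∣+∣q∣≤∣p∪q∣ (outside ∷ p) (outside ∷ q) =
  map₁ (Nonempty-∷ _) (overlap-or-∣p∣+∣q∣≤∣p∪q∣ p q)

sizeBound : ℕ → ℕ
sizeBound t = 2 ^ (t / 2)

sizeBound-2+ : ∀ t → sizeBound (2 + t) ≡ sizeBound t + sizeBound t
sizeBound-2+ t = begin
  2 ^ ((2 + t) / 2)         ≡⟨ cong (2 ^_) (m/n≡1+[m∸n]/n {2 + t} {2} (s≤s (s≤s z≤n))) ⟩
  2 * sizeBound t           ≡⟨ cong (sizeBound t +_) (+-identityʳ (sizeBound t)) ⟩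
  sizeBound t + sizeBound t ∎
  where open ≡-Reasoning

sizeBound-mono : ∀ {t t′} → t ≤ t′ → sizeBound t ≤ sizeBound t′
sizeBound-mono t≤t′ = ^-monoʳ-≤ 2 (/-monoˡ-≤ 2 t≤t′)

2^[t∸1]≤sizeBound[t]² : ∀ t → 2 ^ (t ∸ 1) ≤ sizeBound t ^ 2
2^[t∸1]≤sizeBound[t]² t = begin
  2 ^ (t ∸ 1)       ≤⟨ ^-monoʳ-≤ 2 (m≤n+o⇒m∸n≤o t 1 t≤1+⌊t/2⌋*2) ⟩
  2 ^ (t / 2 * 2)   ≡⟨ ^-*-assoc 2 (t / 2) 2 ⟨
  sizeBound t ^ 2   ∎
  where
  open ≤-Reasoning
  t≤1+⌊t/2⌋*2 : t ≤ 1 + t / 2 * 2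
  t≤1+⌊t/2⌋*2 = subst (_≤ 1 + t / 2 * 2) (sym (m≡m%n+[m/n]*n t 2))
    (+-monoˡ-≤ (t / 2 * 2) (s≤s⁻¹ (m%n<n t 2)))

Predecessor : ∀ {n} → Graph n → Coloring n → Fin n → Set
Predecessor E c b = ∃[ w ] (OtherSide E b w × suc (c w) ≡ c b)

record Invariant {n} (E : Graph n) (c : Coloring n) : Set where
  field
    component-size : ∀ u → ComponentSize≥ E u (sizeBound (c u))
    clash-size : ∀ a a′ → OtherSide E a a′ → c a ≡ c a′
      → ComponentSize≥ E a (sizeBound (2 + c a))
    predecessor-or-size : ∀ b → 2 ≤ c b
      → Predecessor E c b ⊎ ComponentSize≥ E b (sizeBound (1 + c b))
open Invariant

module _ {n : ℕ} {E : Graph n} {c : Coloring n} (I : Invariant E c) where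

  consecutive-colors-size : ∀ {a b} → SameSide E a b → c b ≡ suc (c a) → 1 ≤ c a
    → ComponentSize≥ E a (sizeBound (2 + c a))
  consecutive-colors-size {a} {b} a~b cb≡1+ca 1≤ca
    with predecessor-or-size I b (subst (2 ≤_) (sym cb≡1+ca) (s≤s 1≤ca))
  ... | inj₁ (w , b~w , 1+cw≡cb) =
    clash-size I a w (SameSide-OtherSide-trans a~b b~w) (sym (suc-injective (trans 1+cw≡cb cb≡1+ca)))
  ... | inj₂ size =
    ComponentSize≥-transport (SameSide⇒Connected a~b)
      (subst (ComponentSize≥ E b ∘ sizeBound ∘ (1 +_)) cb≡1+ca size)

  smallest-free-size : ∀ {v z m} → OtherSide E v z → c v ≡ c z
    → IsSmallestFree (OtherSide E v) c m → ComponentSize≥ E v (sizeBound m)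
  smallest-free-size {m = 0} _ _ (() , _)
  smallest-free-size {v} {m = 1} v~z cv≡cz _ =
    ComponentSize≥-mono (sizeBound-mono {1} {2 + c v} (s≤s z≤n)) (clash-size I _ _ v~z cv≡cz)
  smallest-free-size {v} {m = 2} v~z cv≡cz _ =
    ComponentSize≥-mono (sizeBound-mono {2} {2 + c v} (s≤s (s≤s z≤n))) (clash-size I _ _ v~z cv≡cz)
  smallest-free-size {m = suc (suc (suc k))} _ _ (_ , _ , free-below)
    with free-below (2 + k) (s≤s z≤n) ≤-refl | free-below (1 + k) (s≤s z≤n) (n≤1+n _)
  ... | w₁ , v~w₁ , cw₁≡2+k | w₂ , v~w₂ , cw₂≡1+k =
    ComponentSize≥-transport (OtherSide⇒Connected v~w₂)
      (subst (ComponentSize≥ E w₂ ∘ sizeBound ∘ (2 +_)) cw₂≡1+k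
        (consecutive-colors-size (OtherSide-trans (OtherSide-sym v~w₂) v~w₁)
          (trans cw₁≡2+k (cong suc (sym cw₂≡1+k))) (subst (1 ≤_) (sym cw₂≡1+k) (s≤s z≤n))))

invariant-start : ∀ {n} → Invariant {n} [] (λ _ → 1)
invariant-start = record
  { component-size = λ u → ⁅ u ⁆ , ≤-reflexive (sym (∣⁅x⁆∣≡1 u))
      , λ w w∈⁅u⁆ → subst (Connected [] u) (sym (x∈⁅y⁆⇒x≡y u w∈⁅u⁆)) (0 , here)
  ; clash-size = λ { _ _ (_ , step (inj₁ ()) _ , _) _ ; _ _ (_ , step (inj₂ ()) _ , _) _ }
  ; predecessor-or-size = λ { _ (s≤s ()) }
  }

module _ {n : ℕ} {E : Graph n} {c : Coloring n} {e : Edge n}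
  (B : Bipartite (e ∷ E)) (I : Invariant E c) where

  clash-size-insert : ∀ a a′ → OtherSide (e ∷ E) a a′ → c a ≡ c a′
    → ComponentSize≥ (e ∷ E) a (sizeBound (2 + c a))
  clash-size-insert a a′ a~a′ ca≡ca′ with component-size I a | component-size I a′
  ... | S , ≤∣S∣ , S⊆ | S′ , ≤∣S′∣ , S′⊆ with overlap-or-∣p∣+∣q∣≤∣p∪q∣ S S′
  ... | inj₁ (w , w∈S∩S′) =
    let w∈S , w∈S′ = x∈p∩q⁻ S S′ w∈S∩S′
        a~a′-before = Connected-trans (S⊆ w w∈S) (Connected-sym (S′⊆ w w∈S′))
    in ComponentSize≥-weaken (clash-size I a a′ (Connected⇒OtherSide B a~a′-before a~a′) ca≡ca′)
  ... | inj₂ disjoint = S ∪ S′ , size , λ w → [ Connected-weaken ∘ S⊆ w , across w ] ∘ x∈p∪q⁻ S S′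
    where
    open ≤-Reasoning
    size : sizeBound (2 + c a) ≤ ∣ S ∪ S′ ∣
    size = begin
      sizeBound (2 + c a)                 ≡⟨ sizeBound-2+ (c a) ⟩
      sizeBound (c a) + sizeBound (c a)   ≡⟨ cong ((sizeBound (c a) +_) ∘ sizeBound) ca≡ca′ ⟩
      sizeBound (c a) + sizeBound (c a′)  ≤⟨ +-mono-≤ ≤∣S∣ ≤∣S′∣ ⟩
      ∣ S ∣ + ∣ S′ ∣                      ≤⟨ disjoint ⟩
      ∣ S ∪ S′ ∣                          ∎
    across : ∀ w → w ∈ S′ → Connected (e ∷ E) a w
    across w w∈S′ = Connected-trans (OtherSide⇒Connected a~a′) (Connected-weaken (S′⊆ w w∈S′))

  invariant-insert : Invariant (e ∷ E) c
  invariant-insert = record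
    { component-size = ComponentSize≥-weaken ∘ component-size I
    ; clash-size = clash-size-insert
    ; predecessor-or-size = λ b 2≤cb →
        map (λ (w , (k , p , odd) , 1+cw≡cb) → w , (k , Walk-weaken p , odd) , 1+cw≡cb)
            ComponentSize≥-weaken (predecessor-or-size I b 2≤cb)
    }

recolor-cases : ∀ {n} (c : Coloring n) v m w
  → (w ≡ v × recolor c v m w ≡ m) ⊎ (w ≢ v × recolor c v m w ≡ c w)
recolor-cases c v m w with w ≟ v
... | yes w≡v = inj₁ (w≡v , refl)
... | no w≢v = inj₂ (w≢v , refl)

recolor-other : ∀ {n} (c : Coloring n) v m {w} → w ≢ v → recolor c v m w ≡ c w
recolor-other c v m {w} w≢v with recolor-cases c v m w
... | inj₁ (w≡v , _) = ⊥-elim (w≢v w≡v)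
... | inj₂ (_ , c′w≡cw) = c′w≡cw

IsSmallestFree-pred : ∀ {n} {P : Fin n → Set} {c : Coloring n} {m} → IsSmallestFree P c m
  → 2 ≤ m → ∃[ w ] (P w × suc (c w) ≡ m)
IsSmallestFree-pred {m = suc m} (_ , _ , free-below) (s≤s 1≤m)
  with free-below m 1≤m ≤-refl
... | w , Pw , cw≡m = w , Pw , cong suc cw≡m

module _ {n : ℕ} {E : Graph n} {c : Coloring n} {v z : Fin n} {m : ℕ}
  (B : Bipartite E) (I : Invariant E c) (v~z : OtherSide E v z) (cv≡cz : c v ≡ c z)
  (mex : IsSmallestFree (OtherSide E v) c m) where

  private
    c′ : Coloring n
    c′ = recolor c v m

    color-free : ∀ w → OtherSide E v w → c w ≢ m
    color-free = proj₁ (proj₂ mex)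

  recolor-predecessor : 2 ≤ m → c′ v ≡ m → Predecessor E c′ v
  recolor-predecessor 2≤m c′v≡m with IsSmallestFree-pred mex 2≤m
  ... | w , v~w , 1+cw≡m = w , v~w ,
    trans (cong suc (recolor-other c v m (OtherSide-irrefl B v~w ∘ sym))) (trans 1+cw≡m (sym c′v≡m))

  predecessor-or-size-recolor : ∀ b → 2 ≤ c′ b
    → Predecessor E c′ b ⊎ ComponentSize≥ E b (sizeBound (1 + c′ b))
  predecessor-or-size-recolor b 2≤c′b with recolor-cases c v m b
  ... | inj₁ (refl , c′v≡m) = inj₁ (recolor-predecessor (subst (2 ≤_) c′v≡m 2≤c′b) c′v≡m)
  ... | inj₂ (_ , c′b≡cb) with predecessor-or-size I b (subst (2 ≤_) c′b≡cb 2≤c′b)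
  ...   | inj₂ size = inj₂ (subst (ComponentSize≥ E b ∘ sizeBound ∘ (1 +_)) (sym c′b≡cb) size)
  ...   | inj₁ (w , b~w , 1+cw≡cb) with recolor-cases c v m w
  ...     | inj₂ (_ , c′w≡cw) = inj₁ (w , b~w , trans (cong suc c′w≡cw) (trans 1+cw≡cb (sym c′b≡cb)))
  -- The lost predecessor was v itself, so z, colored like v, sits on b's side.
  ...     | inj₁ (refl , _) =
    let b~z = OtherSide-trans b~w v~z
        c′b≡1+cz = trans c′b≡cb (trans (sym 1+cw≡cb) (cong suc cv≡cz))
    in inj₂ (ComponentSize≥-transport (SameSide⇒Connected b~z)
         (subst (ComponentSize≥ E z ∘ sizeBound ∘ (1 +_)) (sym c′b≡1+cz)
           (consecutive-colors-size I (SameSide-sym b~z) (trans (sym c′b≡cb) c′b≡1+cz)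
             (s≤s⁻¹ (subst (2 ≤_) c′b≡1+cz 2≤c′b)))))

  clash-size-recolor : ∀ a a′ → OtherSide E a a′ → c′ a ≡ c′ a′
    → ComponentSize≥ E a (sizeBound (2 + c′ a))
  clash-size-recolor a a′ a~a′ c′a≡c′a′ with recolor-cases c v m a | recolor-cases c v m a′
  ... | inj₁ (refl , _) | inj₁ (refl , _) = ⊥-elim (OtherSide-irrefl B a~a′ refl)
  ... | inj₁ (refl , c′v≡m) | inj₂ (_ , c′a′≡ca′) =
    ⊥-elim (color-free a′ a~a′ (trans (sym c′a′≡ca′) (trans (sym c′a≡c′a′) c′v≡m)))
  ... | inj₂ (_ , c′a≡ca) | inj₁ (refl , c′v≡m) =
    ⊥-elim (color-free a (OtherSide-sym a~a′) (trans (sym c′a≡ca) (trans c′a≡c′a′ c′v≡m)))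
  ... | inj₂ (_ , c′a≡ca) | inj₂ (_ , c′a′≡ca′) =
    subst (ComponentSize≥ E a ∘ sizeBound ∘ (2 +_)) (sym c′a≡ca)
      (clash-size I a a′ a~a′ (trans (sym c′a≡ca) (trans c′a≡c′a′ c′a′≡ca′)))

  component-size-recolor : ∀ u → ComponentSize≥ E u (sizeBound (c′ u))
  component-size-recolor u with recolor-cases c v m u
  ... | inj₁ (refl , c′v≡m) rewrite c′v≡m = smallest-free-size I v~z cv≡cz mex
  ... | inj₂ (_ , c′u≡cu) rewrite c′u≡cu = component-size I u

  invariant-recolor : Invariant E c′
  invariant-recolor = record
    { component-size = component-size-recolor
    ; clash-size = clash-size-recolor
    ; predecessor-or-size = predecessor-or-size-recolor
    }

reachable⇒invariant : ∀ {n} {E : Graph n} {c : Coloring n} → Reachable E c → Invariant E c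
reachable⇒invariant start = invariant-start
reachable⇒invariant (insert-diff r B _) = invariant-insert B (reachable⇒invariant r)
reachable⇒invariant (insert-same r B cx≡cy (inj₁ refl) mex) =
  invariant-recolor B (invariant-insert B (reachable⇒invariant r))
    (Adj⇒OtherSide (inj₁ (here refl))) cx≡cy mex
reachable⇒invariant (insert-same r B cx≡cy (inj₂ refl) mex) =
  invariant-recolor B (invariant-insert B (reachable⇒invariant r))
    (Adj⇒OtherSide (inj₂ (here refl))) (sym cx≡cy) mex

lemma2 : ∀ {n : ℕ} {E : Graph n} {c : Coloring n} → Reachable E c → (u : Fin n)
    → (∃[ S ] ((2 ^ (c u / 2) ≤ ∣ S ∣) × (∀ w → w ∈ S → Connected E u w)))
      × (2 ^ (c u ∸ 1) ≤ n ^ 2)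
lemma2 {c = c} r u =
  size , ≤-trans (2^[t∸1]≤sizeBound[t]² (c u)) (^-monoˡ-≤ 2 (ComponentSize≥⇒≤n size))
  where
  size : ComponentSize≥ _ u (sizeBound (c u))
  size = component-size (reachable⇒invariant r) u
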